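{- For any integers $b\ge 2$ and $n\ge1$, there exists a balanced $b$-ary tree with $n$ vertices.
   Context: A $b$-ary tree is a rooted tree in which every vertex has at most $b$ children. The level of a vertex is its distance from the root; the $\ell$-th level is the set of vertices at level $\ell$, and it is filled if it contains $b^\ell$ vertices. For a vertex $x$, $n_x$ is the number of vertices in the subtree rooted at $x$. A rooted $b$-ary tree is balanced if (1) every non-empty level, except possibly the last non-empty one, is filled, and (2) for any two vertices $x,y$ on the same level, $|n_x-n_y|\le 1$. -}

module Defs where

open import Data.Nat using (ℕ; zero; suc; _+_; _^_; _≤_; _<_)
open import Data.List using (List; []; _∷_; _++_; length)
open import Data.List.Relation.Unary.All using (All)
open import Data.List.Membership.Propositional using (_∈_)
open import Relation.Binary.PropositionalEquality using (_≡_)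

data Tree : Set where
  node : List Tree → Tree

mutual
  size : Tree → ℕ
  size (node ts) = suc (sizes ts)

  sizes : List Tree → ℕ
  sizes []       = 0
  sizes (t ∷ ts) = size t + sizes ts

mutual
  -- the subtrees rooted at the vertices of level ℓ (one entry per vertex)
  levelTrees : ℕ → Tree → List Tree
  levelTrees zero    t         = t ∷ []
  levelTrees (suc ℓ) (node ts) = levelTreesL ℓ ts

  levelTreesL : ℕ → List Tree → List Tree
  levelTreesL ℓ []       = []
  levelTreesL ℓ (t ∷ ts) = levelTrees ℓ t ++ levelTreesL ℓ ts

levelSize : ℕ → Tree → ℕ
levelSize ℓ t = length (levelTrees ℓ t)

data BAry (b : ℕ) : Tree → Set where
  node : ∀ {ts} → length ts ≤ b → All (BAry b) ts → BAry b (node ts)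

record Balanced (b : ℕ) (t : Tree) : Set where
  field
    -- (1) every non-empty level other than the last non-empty one is filled:
    --     if some later level m > ℓ is non-empty, level ℓ has b^ℓ vertices
    filled : ∀ ℓ m → ℓ < m → 0 < levelSize m t → levelSize ℓ t ≡ b ^ ℓ
    nearlyEqual : ∀ ℓ x y → x ∈ levelTrees ℓ t → y ∈ levelTrees ℓ t →
                  size x ≤ suc (size y)

-- Give the root of a tree with n = 1 + q b + r vertices (r < b) exactly r children with q + 1
-- vertices and b − r children with q vertices (none of the latter when q = 0), and build the
-- children recursively the same way. If the vertices of one level all have size s or s + 1, those
-- of the next level all have size s′ or s′ + 1 with s′ = ⌊(s − 1)/b⌋, which gives condition (2).
-- For (1): if a level below ℓ is non-empty, some vertex on level ℓ has size at least 2, so the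
-- lower bound s on level ℓ is positive. Then every bound s above level ℓ has ⌊(s − 1)/b⌋ ≥ 1,
-- so every vertex there has more than b vertices, hence exactly b children.
module Submission where

open import Defs
open import Data.Nat using (ℕ; _≤_)
open import Data.Product using (Σ; _×_)
open import Relation.Binary.PropositionalEquality using (_≡_)

open import Data.Nat using (_<?_; zero; suc; _+_; _*_; _∸_; _^_; _<_; z≤n; s≤s; pred; NonZero; >-nonZero)
open import Data.Nat.Properties
open import Data.Nat.DivMod
open import Data.Nat.ListAction using (sum)
open import Data.Nat.ListAction.Properties using (sum-++)
open import Data.Product as Product using (_,_; proj₁; proj₂)
open import Data.Sum using (_⊎_; inj₁; inj₂)
open import Data.List using (List; []; _∷_; _++_; length; replicate)
open import Data.List.Properties using (length-++; length-replicate)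
open import Data.List.Relation.Unary.All as All using (All; []; _∷_)
open import Data.List.Relation.Unary.All.Properties using (++⁺; replicate⁺)
open import Data.List.Relation.Unary.Any using (Any; here)
open import Data.List.Relation.Unary.Any.Properties using (++⁺ˡ; ++⁺ʳ)
open import Data.List.Relation.Binary.Pointwise using (Pointwise; []; _∷_; Pointwise-length)
open import Function using (_∘_)
open import Relation.Nullary using (yes; no)
open import Relation.Binary.PropositionalEquality using (refl; sym; trans; cong; cong₂; subst; subst₂; module ≡-Reasoning)
open import Data.Nat.Induction using (<-rec)

sum-replicate : ∀ n m → sum (replicate n m) ≡ n * m
sum-replicate zero    m = refl
sum-replicate (suc n) m = cong (m +_) (sum-replicate n m)

All-≤-sum : ∀ xs → All (_≤ sum xs) xs
All-≤-sum []       = []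
All-≤-sum (x ∷ xs) = m≤m+n x (sum xs) ∷ All.map (λ y≤ → ≤-trans y≤ (m≤n+m (sum xs) x)) (All-≤-sum xs)

0<length-++ : ∀ {A : Set} (xs : List A) {ys} → 0 < length (xs ++ ys) → 0 < length xs ⊎ 0 < length ys
0<length-++ []      0<ys = inj₂ 0<ys
0<length-++ (_ ∷ _) _    = inj₁ (s≤s z≤n)

0<size : ∀ t → 0 < size t
0<size (node _) = s≤s z≤n

mutual
  nonempty-deeper-level⇒nonleaf : ∀ ℓ m t → ℓ < m → 0 < levelSize m t →
                                  Any (λ x → 2 ≤ size x) (levelTrees ℓ t)
  nonempty-deeper-level⇒nonleaf zero (suc m) (node (t ∷ ts)) _ _ =
    here (s≤s (≤-trans (0<size t) (m≤m+n (size t) (sizes ts))))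
  nonempty-deeper-level⇒nonleaf (suc ℓ) (suc m) (node ts) (s≤s ℓ<m) 0<level =
    nonempty-deeper-level⇒nonleafs ℓ m ts ℓ<m 0<level

  nonempty-deeper-level⇒nonleafs : ∀ ℓ m ts → ℓ < m → 0 < length (levelTreesL m ts) →
                                   Any (λ x → 2 ≤ size x) (levelTreesL ℓ ts)
  nonempty-deeper-level⇒nonleafs ℓ m (t ∷ ts) ℓ<m 0<level with 0<length-++ (levelTrees m t) 0<level
  ... | inj₁ 0<t  = ++⁺ˡ (nonempty-deeper-level⇒nonleaf ℓ m t ℓ<m 0<t)
  ... | inj₂ 0<ts = ++⁺ʳ (levelTrees ℓ t) (nonempty-deeper-level⇒nonleafs ℓ m ts ℓ<m 0<ts)

Near : ℕ → ℕ → Set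
Near s c = s ≤ c × c ≤ suc s

module CanonicalTree (b : ℕ) .{{_ : NonZero b}} where

  suc-/ : ∀ k → suc k / b ≡ k / b ⊎ (suc k / b ≡ suc (k / b) × suc k % b ≡ 0)
  suc-/ k with suc (k % b) <? b
  ... | yes 1+r<b = inj₁ (begin
    (1 + k) / b    ≡⟨ +-distrib-/ 1 k (subst (λ x → x + k % b < b) (sym (m<n⇒m%n≡m 1<b)) 1+r<b) ⟩
    1 / b + k / b  ≡⟨ cong (_+ k / b) (m<n⇒m/n≡0 1<b) ⟩
    k / b          ∎)
    where
    open ≡-Reasoning
    1<b : 1 < b
    1<b = ≤-trans (s≤s (s≤s z≤n)) 1+r<b
  ... | no 1+r≮b = inj₂ (trans (cong (_/ b) 1+k≡[1+q]b) (m*n/n≡m (suc (k / b)) b) ,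
                         trans (cong (_% b) 1+k≡[1+q]b) (m*n%n≡0 (suc (k / b)) b))
    where
    1+k≡[1+q]b : suc k ≡ suc (k / b) * b
    1+k≡[1+q]b = trans (cong suc (m≡m%n+[m/n]*n k b))
                       (cong (_+ k / b * b) (≤∧≮⇒≡ (m%n<n k b) 1+r≮b))

  parts : ℕ → ℕ → List ℕ
  parts zero    r = replicate r 1
  parts (suc q) r = replicate r (2 + q) ++ replicate (b ∸ r) (suc q)

  sum-parts : ∀ q {r} → r ≤ b → sum (parts q r) ≡ q * b + r
  sum-parts zero    {r} _   = trans (sum-replicate r 1) (*-identityʳ r)
  sum-parts (suc q) {r} r≤b = begin
    sum (replicate r (2 + q) ++ replicate (b ∸ r) (suc q))
      ≡⟨ sum-++ (replicate r (2 + q)) (replicate (b ∸ r) (suc q)) ⟩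
    sum (replicate r (2 + q)) + sum (replicate (b ∸ r) (suc q))
      ≡⟨ cong₂ _+_ (sum-replicate r (2 + q)) (sum-replicate (b ∸ r) (suc q)) ⟩
    r * (2 + q) + (b ∸ r) * suc q      ≡⟨ cong (_+ (b ∸ r) * suc q) (*-suc r (suc q)) ⟩
    (r + r * suc q) + (b ∸ r) * suc q  ≡⟨ +-assoc r (r * suc q) ((b ∸ r) * suc q) ⟩
    r + (r * suc q + (b ∸ r) * suc q)  ≡⟨ cong (r +_) (*-distribʳ-+ (suc q) r (b ∸ r)) ⟨
    r + (r + (b ∸ r)) * suc q          ≡⟨ cong (λ x → r + x * suc q) (m+[n∸m]≡n r≤b) ⟩
    r + b * suc q                      ≡⟨ +-comm r (b * suc q) ⟩
    b * suc q + r                      ≡⟨ cong (_+ r) (*-comm b (suc q)) ⟩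
    suc q * b + r                      ∎
    where open ≡-Reasoning

  length-parts : ∀ q {r} → r ≤ b → 0 < q → length (parts q r) ≡ b
  length-parts (suc q) {r} r≤b _ = begin
    length (replicate r (2 + q) ++ replicate (b ∸ r) (suc q))
      ≡⟨ length-++ (replicate r (2 + q)) ⟩
    length (replicate r (2 + q)) + length (replicate (b ∸ r) (suc q))
      ≡⟨ cong₂ _+_ (length-replicate r) (length-replicate (b ∸ r)) ⟩
    r + (b ∸ r)
      ≡⟨ m+[n∸m]≡n r≤b ⟩
    b ∎
    where open ≡-Reasoning

  length-parts-≤ : ∀ q {r} → r ≤ b → length (parts q r) ≤ b
  length-parts-≤ zero    {r} r≤b = subst (_≤ b) (sym (length-replicate r)) r≤b
  length-parts-≤ (suc q)     r≤b = ≤-reflexive (length-parts (suc q) r≤b (s≤s z≤n))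

  parts-near : ∀ q r → All (Near q) (parts q r)
  parts-near zero    r = replicate⁺ r (z≤n , ≤-refl)
  parts-near (suc q) r =
    ++⁺ (replicate⁺ r (n≤1+n (suc q) , ≤-refl)) (replicate⁺ (b ∸ r) (≤-refl , n≤1+n (suc q)))

  parts-positive : ∀ q r → All (0 <_) (parts q r)
  parts-positive zero    r = replicate⁺ r (s≤s z≤n)
  parts-positive (suc q) r = ++⁺ (replicate⁺ r (s≤s z≤n)) (replicate⁺ (b ∸ r) (s≤s z≤n))

  -- m counts the vertices below the root
  childSizes : ℕ → List ℕ
  childSizes m = parts (m / b) (m % b)

  sum-childSizes : ∀ m → sum (childSizes m) ≡ m
  sum-childSizes m = trans (sum-parts (m / b) (m%n≤n m b))
                           (trans (+-comm (m / b * b) (m % b)) (sym (m≡m%n+[m/n]*n m b)))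

  childSizes-bounded : ∀ m → All (λ c → 0 < c × c ≤ m) (childSizes m)
  childSizes-bounded m = All.zip (parts-positive (m / b) (m % b) ,
    subst (λ x → All (_≤ x) (childSizes m)) (sum-childSizes m) (All-≤-sum (childSizes m)))

  lower : ℕ → ℕ
  lower s = pred s / b

  lower^ : ℕ → ℕ → ℕ
  lower^ zero    s = s
  lower^ (suc ℓ) s = lower^ ℓ (lower s)

  lower^-≤ : ∀ ℓ s → lower^ ℓ s ≤ s
  lower^-≤ zero    s = ≤-refl
  lower^-≤ (suc ℓ) s = ≤-trans (lower^-≤ ℓ (lower s)) (≤-trans (m/n≤m (pred s) b) pred[n]≤n)

  childSizes-near-lower : ∀ m → All (Near (lower m)) (childSizes m)
  childSizes-near-lower zero = parts-near (0 / b) (0 % b)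
  childSizes-near-lower (suc k) with suc-/ k
  ... | inj₁ q≡ =
    subst (λ q → All (Near q) (childSizes (suc k))) q≡ (parts-near (suc k / b) (suc k % b))
  ... | inj₂ (q≡ , r≡0) =
    subst₂ (λ q r → All (Near (k / b)) (parts q r)) (sym q≡) (sym r≡0) (replicate⁺ b (n≤1+n (k / b) , ≤-refl))

  childSizes-near : ∀ {s m} → Near s (suc m) → All (Near (lower s)) (childSizes m)
  childSizes-near {s} {m} (s≤1+m , 1+m≤1+s) with m≤n⇒m<n∨m≡n s≤1+m
  ... | inj₂ refl = parts-near (m / b) (m % b)
  ... | inj₁ s<1+m with ≤-antisym (≤-pred s<1+m) (≤-pred 1+m≤1+s)
  ...   | refl = childSizes-near-lower m

  length-childSizes : ∀ {s m} → Near s (suc m) → 0 < lower s → length (childSizes m) ≡ b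
  length-childSizes {m = m} (s≤1+m , _) 0<lower =
    length-parts (m / b) (m%n≤n m b) (≤-trans 0<lower (/-monoˡ-≤ b (pred-mono-≤ s≤1+m)))

  data Canonical : ℕ → Tree → Set where
    node : ∀ {m ts} → Pointwise Canonical (childSizes m) ts → Canonical (suc m) (node ts)

  canonical : ∀ m → Σ Tree (Canonical (suc m))
  canonical = <-rec (λ m → Σ Tree (Canonical (suc m)))
                    (λ m rec → Product.map node node (forest rec (childSizes m) (childSizes-bounded m)))
    where
    forest : ∀ {m} → (∀ {k} → k < m → Σ Tree (Canonical (suc k))) →
             ∀ cs → All (λ c → 0 < c × c ≤ m) cs → Σ (List Tree) (Pointwise Canonical cs)
    forest rec []           []                  = [] , []
    forest rec (suc k ∷ cs) ((_ , k<m) ∷ bounds) = Product.zip _∷_ _∷_ (rec k<m) (forest rec cs bounds)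

  mutual
    size-canonical : ∀ {n t} → Canonical n t → size t ≡ n
    size-canonical (node {m} cs) = cong suc (trans (sizes-canonical cs) (sum-childSizes m))

    sizes-canonical : ∀ {ns ts} → Pointwise Canonical ns ts → sizes ts ≡ sum ns
    sizes-canonical []       = refl
    sizes-canonical (c ∷ cs) = cong₂ _+_ (size-canonical c) (sizes-canonical cs)

  mutual
    canonical-bary : ∀ {n t} → Canonical n t → BAry b t
    canonical-bary (node {m} cs) =
      node (subst (_≤ b) (Pointwise-length cs) (length-parts-≤ (m / b) (m%n≤n m b))) (canonicals-bary cs)

    canonicals-bary : ∀ {ns ts} → Pointwise Canonical ns ts → All (BAry b) ts
    canonicals-bary []       = []
    canonicals-bary (c ∷ cs) = canonical-bary c ∷ canonicals-bary cs

  mutual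
    levelTrees-near : ∀ ℓ {s n t} → Canonical n t → Near s n →
                      All (Near (lower^ ℓ s) ∘ size) (levelTrees ℓ t)
    levelTrees-near zero    {s} c        near = subst (Near s) (sym (size-canonical c)) near ∷ []
    levelTrees-near (suc ℓ)     (node cs) near = levelTreesL-near ℓ cs (childSizes-near near)

    levelTreesL-near : ∀ ℓ {s ns ts} → Pointwise Canonical ns ts → All (Near s) ns →
                       All (Near (lower^ ℓ s) ∘ size) (levelTreesL ℓ ts)
    levelTreesL-near ℓ []       []             = []
    levelTreesL-near ℓ (c ∷ cs) (near ∷ nears) =
      ++⁺ (levelTrees-near ℓ c near) (levelTreesL-near ℓ cs nears)

  mutual
    levelSize-filled : ∀ ℓ {s n t} → Canonical n t → Near s n → 0 < lower^ ℓ s → levelSize ℓ t ≡ b ^ ℓ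
    levelSize-filled zero _ _ _ = refl
    levelSize-filled (suc ℓ) {s} {t = node ts} (node {m} cs) near pos = begin
      length (levelTreesL ℓ ts)      ≡⟨ levelTreesL-filled ℓ cs (childSizes-near near) pos ⟩
      length ts * b ^ ℓ              ≡⟨ cong (_* b ^ ℓ) (sym (Pointwise-length cs)) ⟩
      length (childSizes m) * b ^ ℓ  ≡⟨ cong (_* b ^ ℓ) (length-childSizes near (≤-trans pos (lower^-≤ ℓ (lower s)))) ⟩
      b * b ^ ℓ                      ∎
      where open ≡-Reasoning

    levelTreesL-filled : ∀ ℓ {s ns ts} → Pointwise Canonical ns ts → All (Near s) ns → 0 < lower^ ℓ s →
                         length (levelTreesL ℓ ts) ≡ length ts * b ^ ℓ
    levelTreesL-filled ℓ []       []             _   = refl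
    levelTreesL-filled ℓ {ts = t ∷ ts} (c ∷ cs) (near ∷ nears) pos =
      trans (length-++ (levelTrees ℓ t))
            (cong₂ _+_ (levelSize-filled ℓ c near pos) (levelTreesL-filled ℓ cs nears pos))

  canonical-balanced : ∀ {n t} → Canonical n t → Balanced b t
  canonical-balanced {n} {t} c = record
    { filled      = λ ℓ m ℓ<m 0<level → levelSize-filled ℓ c self-near (positive ℓ m ℓ<m 0<level)
    ; nearlyEqual = λ ℓ x y x∈ y∈ →
        ≤-trans (proj₂ (All.lookup (near ℓ) x∈)) (s≤s (proj₁ (All.lookup (near ℓ) y∈)))
    }
    where
    self-near : Near n n
    self-near = ≤-refl , n≤1+n n

    near : ∀ ℓ → All (Near (lower^ ℓ n) ∘ size) (levelTrees ℓ t)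
    near ℓ = levelTrees-near ℓ c self-near

    positive : ∀ ℓ m → ℓ < m → 0 < levelSize m t → 0 < lower^ ℓ n
    positive ℓ m ℓ<m 0<level with All.lookupAny (near ℓ) (nonempty-deeper-level⇒nonleaf ℓ m t ℓ<m 0<level)
    ... | (_ , size≤) , 2≤size = ≤-pred (≤-trans 2≤size size≤)

lemma8 : (b n : ℕ) → 2 ≤ b → 1 ≤ n →
         Σ Tree (λ t → BAry b t × Balanced b t × size t ≡ n)
lemma8 b (suc m) 2≤b _ =
  Product.map₂ (λ c → canonical-bary c , canonical-balanced c , size-canonical c) (canonical m)
  where open CanonicalTree b {{>-nonZero (≤-trans (s≤s z≤n) 2≤b)}}
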